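{- For $h\ge1$ let $\Delta_h$ be the pBPA with stack alphabet $\Gamma_h=\{X_1,\dots,X_h\}$ and rules $X_i\overset{1/2}{\hookrightarrow}X_iX_i$ and $X_i\overset{1/2}{\hookrightarrow}X_{i-1}$ for $2\le i\le h$, and $X_1\overset{1/2}{\hookrightarrow}X_1X_1$, $X_1\overset{1/2}{\hookrightarrow}\varepsilon$. Then $\mathcal{P}(\mathbf{T}_{X_h}<\infty)=1$, $E[X_h]=\infty$, and there is $c_h>0$ with \[\frac{c_h}{n^{1/2^h}}\le\mathcal{P}(\mathbf{T}_{X_h}\ge n)\qquad\text{for all }n\in\mathbb{N}.\]
   Context: A pBPA with rules $X\overset{p}{\hookrightarrow}\alpha$ induces a Markov chain on $\Gamma^*$: $X\beta\to\alpha\beta$ with probability $p$ for each rule, and $\varepsilon\to\varepsilon$ with probability $1$; $\mathcal{P}$ is the standard probability measure on runs from a start configuration. $\mathbf{T}_\alpha(w)$ is the least $n\ge0$ with $w(n)=\varepsilon$ (or $\infty$), and $E[\alpha]$ is its expectation. -}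

module Defs where

open import Data.Nat as ℕ using (ℕ; zero; suc)
open import Data.Fin using (Fin; zero; suc; inject₁; fromℕ)
open import Data.List using (List; []; _∷_; _++_)
open import Data.Product using (_×_; _,_)
open import Data.Integer using (+_)
open import Data.Rational using (ℚ; 0ℚ; 1ℚ; ½; _+_; _*_; _/_)

_^ℚ_ : ℚ → ℕ → ℚ
q ^ℚ zero    = 1ℚ
q ^ℚ (suc n) = q * (q ^ℚ n)

ℕ→ℚ : ℕ → ℚ
ℕ→ℚ n = (+ n) / 1

-- A pBPA over a finite stack alphabet Γ = Fin k.
-- rules X = list of (p , α), meaning X ↪[p] α.
record PBPA (k : ℕ) : Set where
  field
    rules : Fin k → List (ℚ × List (Fin k))
open PBPA public

-- Surv Δ m α = 𝒫(w(m) ≠ ε) for runs w of the induced Markov chain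
-- started in α, i.e. 𝒫(T_α > m) (ε is absorbing).
Surv : ∀ {k} → PBPA k → ℕ → List (Fin k) → ℚ
Surv Δ zero    []      = 0ℚ
Surv Δ zero    (_ ∷ _) = 1ℚ
Surv Δ (suc m) []      = 0ℚ
Surv Δ (suc m) (X ∷ β) = go (rules Δ X)
  where
  go : List (ℚ × List _) → ℚ
  go []             = 0ℚ
  go ((p , γ) ∷ rs) = p * Surv Δ m (γ ++ β) + go rs

ProbTGe : ∀ {k} → PBPA k → List (Fin k) → ℕ → ℚ
ProbTGe Δ α zero    = 1ℚ
ProbTGe Δ α (suc m) = Surv Δ m α

-- Partial sums Σ_{m<N} 𝒫(T_α > m); E[α] = sup_N of these.
ExpPartial : ∀ {k} → PBPA k → List (Fin k) → ℕ → ℚ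
ExpPartial Δ α zero    = 0ℚ
ExpPartial Δ α (suc N) = ExpPartial Δ α N + Surv Δ N α

-- Δ_h with h = suc h'. X_i is represented by the index i-1 : Fin h.
Δ : (h' : ℕ) → PBPA (suc h')
rules (Δ h') zero    = (½ , zero ∷ zero ∷ []) ∷ (½ , []) ∷ []
rules (Δ h') (suc j) = (½ , suc j ∷ suc j ∷ []) ∷ (½ , inject₁ j ∷ []) ∷ []

Xtop : (h' : ℕ) → Fin (suc h')
Xtop h' = fromℕ h'

-- Lower bound: under X₁ the stack height is a fair random walk, so S m [X₁] ≳ m^(−1/2); and if X_i
-- survives m steps with probability at least t², then X_(i+1) survives with probability at least t.
-- Climbing the h levels gives S m [X_h] ≳ m^(−1/2^h), so Σ_m S m [X_h] = E[X_h] diverges.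
-- Upper bound: give X_i the weight u^(2^(h−i)). Along the chain, the product of 1 − 2·weight over the
-- stack, divided by (1 − u^(2^h))^m, is a submartingale; hence S m [X_h] ≤ 2u + (1 − u^(2^h))^m,
-- which is small for u small and m large.

module Submission where

open import Defs
open import Data.Nat as ℕ using (ℕ; zero; suc; _^_)
import Data.Nat.Properties as ℕ
open import Data.Fin using (Fin; zero; suc; inject₁; fromℕ; toℕ)
open import Data.Fin.Properties using (toℕ-inject₁; toℕ-fromℕ)
open import Data.Fin.Induction using (<-weakInduction)
open import Data.List using (List; []; _∷_; _++_; replicate)
open import Data.Product using (_×_; _,_; ∃-syntax)
open import Data.Sum using (inj₁; inj₂)
open import Data.Integer as ℤ using (+_)
import Data.Integer.Properties as ℤ
open import Data.Nat.Coprimality using (1-coprimeTo)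
import Data.Nat.Coprimality as Coprimality
open import Data.Rational
  using (ℚ; mkℚ; 0ℚ; 1ℚ; ½; _+_; _*_; -_; _-_; _≤_; _<_; _/_; *≤*; *<*; 1/_; positive; nonNegative)
open import Data.Rational.Properties
open import Algebra.Bundles using (CommutativeRing)
open import Algebra.Properties.CommutativeSemiring.Exp
  (CommutativeRing.commutativeSemiring +-*-commutativeRing)
  using (^-homo-*; ^-assocʳ; ^-distrib-*)
  renaming (_^_ to _^ᶜ_)
open import Level using (0ℓ)
open import Relation.Binary.PropositionalEquality
open import Relation.Nullary.Decidable.Core using (yes; no; dec⇒maybe)
open import Relation.Nullary.Negation using (contradiction)
open import Tactic.RingSolver using (solve-∀)
open import Tactic.RingSolver.Core.AlmostCommutativeRing
  using (AlmostCommutativeRing; fromCommutativeRing)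

ℚ-ring : AlmostCommutativeRing 0ℓ 0ℓ
ℚ-ring = fromCommutativeRing +-*-commutativeRing (λ p → dec⇒maybe (0ℚ ≟ p))

open ≤-Reasoning

0≤1 : 0ℚ ≤ 1ℚ
0≤1 = ≤ᵇ⇒≤ _

0<1 : 0ℚ < 1ℚ
0<1 = *<* (ℤ.+<+ ℕ.z<s)

0≤2 : 0ℚ ≤ 1ℚ + 1ℚ
0≤2 = ≤ᵇ⇒≤ _

0<½ : 0ℚ < ½
0<½ = *<* (ℤ.+<+ ℕ.z<s)

0≤½ : 0ℚ ≤ ½
0≤½ = ≤ᵇ⇒≤ _

½≤1 : ½ ≤ 1ℚ
½≤1 = ≤ᵇ⇒≤ _

≤-by-gap : ∀ {p q} r → 0ℚ ≤ r → p + r ≡ q → p ≤ q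
≤-by-gap {p} r 0≤r refl = begin
  p       ≡⟨ +-identityʳ p ⟨
  p + 0ℚ  ≤⟨ +-monoʳ-≤ p 0≤r ⟩
  p + r   ∎

*-nonNeg : ∀ {p q} → 0ℚ ≤ p → 0ℚ ≤ q → 0ℚ ≤ p * q
*-nonNeg {p} {q} 0≤p 0≤q = nonNegative⁻¹ (p * q)
  {{nonNeg*nonNeg⇒nonNeg p {{nonNegative 0≤p}} q {{nonNegative 0≤q}}}}

+-nonNeg : ∀ {p q} → 0ℚ ≤ p → 0ℚ ≤ q → 0ℚ ≤ p + q
+-nonNeg = +-mono-≤

*-monoˡ-≤-0≤ : ∀ {r p q} → 0ℚ ≤ r → p ≤ q → r * p ≤ r * q
*-monoˡ-≤-0≤ {r} 0≤r = *-monoˡ-≤-nonNeg r {{nonNegative 0≤r}}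

*-monoʳ-≤-0≤ : ∀ {r p q} → 0ℚ ≤ r → p ≤ q → p * r ≤ q * r
*-monoʳ-≤-0≤ {r} 0≤r = *-monoʳ-≤-nonNeg r {{nonNegative 0≤r}}

*-mono-≤-0≤ : ∀ {p q r s} → 0ℚ ≤ p → p ≤ q → 0ℚ ≤ r → r ≤ s → p * r ≤ q * s
*-mono-≤-0≤ 0≤p p≤q 0≤r r≤s = ≤-trans (*-monoʳ-≤-0≤ 0≤r p≤q) (*-monoˡ-≤-0≤ (≤-trans 0≤p p≤q) r≤s)

½-average-mono-≤ : ∀ {p q r s} → p ≤ q → r ≤ s → ½ * p + ½ * r ≤ ½ * q + ½ * s
½-average-mono-≤ p≤q r≤s = +-mono-≤ (*-monoˡ-≤-0≤ 0≤½ p≤q) (*-monoˡ-≤-0≤ 0≤½ r≤s)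

p≤q⇒0≤q-p : ∀ {p q} → p ≤ q → 0ℚ ≤ q - p
p≤q⇒0≤q-p {p} {q} p≤q = begin
  0ℚ     ≡⟨ +-inverseʳ p ⟨
  p - p  ≤⟨ +-monoˡ-≤ (- p) p≤q ⟩
  q - p  ∎

1-‿antimono-≤ : ∀ {p q} → p ≤ q → 1ℚ - q ≤ 1ℚ - p
1-‿antimono-≤ p≤q = +-monoʳ-≤ 1ℚ (neg-antimono-≤ p≤q)

1-‿cancel-≤ : ∀ {p q} → 1ℚ - q ≤ 1ℚ - p → p ≤ q
1-‿cancel-≤ {p} {q} 1-q≤1-p = begin
  p                 ≡⟨ 1-[1-x]≡x p ⟨
  1ℚ - (1ℚ - p)     ≤⟨ 1-‿antimono-≤ 1-q≤1-p ⟩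
  1ℚ - (1ℚ - q)     ≡⟨ 1-[1-x]≡x q ⟩
  q                 ∎
  where
  1-[1-x]≡x : ∀ x → 1ℚ - (1ℚ - x) ≡ x
  1-[1-x]≡x = solve-∀ ℚ-ring

*-pos : ∀ {p q} → 0ℚ < p → 0ℚ < q → 0ℚ < p * q
*-pos {p} {q} 0<p 0<q = positive⁻¹ (p * q) {{pos*pos⇒pos p {{positive 0<p}} q {{positive 0<q}}}}

2≤2^[1+n] : ∀ n → 2 ℕ.≤ 2 ^ suc n
2≤2^[1+n] n = ℕ.*-monoʳ-≤ 2 (ℕ.m^n>0 2 n)

^ℚ-as-^ᶜ : ∀ x n → x ^ℚ n ≡ x ^ᶜ n
^ℚ-as-^ᶜ x zero    = refl
^ℚ-as-^ᶜ x (suc n) = cong (x *_) (^ℚ-as-^ᶜ x n)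

^ℚ-homo-+ : ∀ x m n → x ^ℚ (m ℕ.+ n) ≡ x ^ℚ m * x ^ℚ n
^ℚ-homo-+ x m n = trans (^ℚ-as-^ᶜ x (m ℕ.+ n))
  (trans (^-homo-* x m n) (sym (cong₂ _*_ (^ℚ-as-^ᶜ x m) (^ℚ-as-^ᶜ x n))))

^ℚ-assocʳ : ∀ x m n → (x ^ℚ m) ^ℚ n ≡ x ^ℚ (m ℕ.* n)
^ℚ-assocʳ x m n = trans (trans (^ℚ-as-^ᶜ (x ^ℚ m) n) (cong (_^ᶜ n) (^ℚ-as-^ᶜ x m)))
  (trans (^-assocʳ x m n) (sym (^ℚ-as-^ᶜ x (m ℕ.* n))))

^ℚ-distrib-* : ∀ x y n → (x * y) ^ℚ n ≡ x ^ℚ n * y ^ℚ n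
^ℚ-distrib-* x y n = trans (^ℚ-as-^ᶜ (x * y) n)
  (trans (^-distrib-* x y n) (sym (cong₂ _*_ (^ℚ-as-^ᶜ x n) (^ℚ-as-^ᶜ y n))))

^ℚ-2^-suc : ∀ x n → x ^ℚ (2 ^ suc n) ≡ x ^ℚ (2 ^ n) * x ^ℚ (2 ^ n)
^ℚ-2^-suc x n = trans (cong (λ e → x ^ℚ (2 ^ n ℕ.+ e)) (ℕ.+-identityʳ (2 ^ n)))
  (^ℚ-homo-+ x (2 ^ n) (2 ^ n))

^ℚ-nonNeg : ∀ {x} → 0ℚ ≤ x → ∀ n → 0ℚ ≤ x ^ℚ n
^ℚ-nonNeg 0≤x zero    = ≤ᵇ⇒≤ _
^ℚ-nonNeg 0≤x (suc n) = *-nonNeg 0≤x (^ℚ-nonNeg 0≤x n)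

^ℚ-pos : ∀ {x} → 0ℚ < x → ∀ n → 0ℚ < x ^ℚ n
^ℚ-pos 0<x zero    = 0<1
^ℚ-pos 0<x (suc n) = *-pos 0<x (^ℚ-pos 0<x n)

^ℚ-mono-≤ : ∀ {x y} → 0ℚ ≤ x → x ≤ y → ∀ n → x ^ℚ n ≤ y ^ℚ n
^ℚ-mono-≤ 0≤x x≤y zero    = ≤-refl
^ℚ-mono-≤ 0≤x x≤y (suc n) = *-mono-≤-0≤ 0≤x x≤y (^ℚ-nonNeg 0≤x n) (^ℚ-mono-≤ 0≤x x≤y n)

^ℚ-≤1 : ∀ {x} → 0ℚ ≤ x → x ≤ 1ℚ → ∀ n → x ^ℚ n ≤ 1ℚ
^ℚ-≤1 0≤x x≤1 n = ≤-trans (^ℚ-mono-≤ 0≤x x≤1 n) (≤-reflexive (1^ℚn n))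
  where
  1^ℚn : ∀ n → 1ℚ ^ℚ n ≡ 1ℚ
  1^ℚn zero    = refl
  1^ℚn (suc n) = trans (*-identityˡ _) (1^ℚn n)

^ℚ-antitoneʳ : ∀ {x} → 0ℚ ≤ x → x ≤ 1ℚ → ∀ {m n} → m ℕ.≤ n → x ^ℚ n ≤ x ^ℚ m
^ℚ-antitoneʳ {x} 0≤x x≤1 {m} {n} m≤n with ℕ.m≤n⇒∃[o]m+o≡n m≤n
... | o , refl = begin
  x ^ℚ (m ℕ.+ o)     ≡⟨ ^ℚ-homo-+ x m o ⟩
  x ^ℚ m * x ^ℚ o    ≤⟨ *-monoˡ-≤-0≤ (^ℚ-nonNeg 0≤x m) (^ℚ-≤1 0≤x x≤1 o) ⟩
  x ^ℚ m * 1ℚ        ≡⟨ *-identityʳ _ ⟩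
  x ^ℚ m             ∎

^ℚ-≥1 : ∀ {x} → 1ℚ ≤ x → ∀ n → 1ℚ ≤ x ^ℚ n
^ℚ-≥1 1≤x zero    = ≤-refl
^ℚ-≥1 1≤x (suc n) = *-mono-≤-0≤ (≤ᵇ⇒≤ _) 1≤x (≤ᵇ⇒≤ _) (^ℚ-≥1 1≤x n)

^ℚ-monoʳ-≤ : ∀ {x} → 1ℚ ≤ x → ∀ {m n} → m ℕ.≤ n → x ^ℚ m ≤ x ^ℚ n
^ℚ-monoʳ-≤ {x} 1≤x {m} {n} m≤n with ℕ.m≤n⇒∃[o]m+o≡n m≤n
... | o , refl = begin
  x ^ℚ m             ≡⟨ *-identityʳ _ ⟨
  x ^ℚ m * 1ℚ        ≤⟨ *-monoˡ-≤-0≤ (^ℚ-nonNeg 0≤x m) (^ℚ-≥1 1≤x o) ⟩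
  x ^ℚ m * x ^ℚ o    ≡⟨ ^ℚ-homo-+ x m o ⟨
  x ^ℚ (m ℕ.+ o)     ∎
  where 0≤x = ≤-trans (≤ᵇ⇒≤ _) 1≤x

^ℚ-mono-< : ∀ {x y} → 0ℚ ≤ x → x < y → ∀ n → x ^ℚ suc n < y ^ℚ suc n
^ℚ-mono-< {x} {y} 0≤x x<y n = begin-strict
  x * x ^ℚ n  ≤⟨ *-monoˡ-≤-0≤ 0≤x (^ℚ-mono-≤ 0≤x (<⇒≤ x<y) n) ⟩
  x * y ^ℚ n  <⟨ *-monoˡ-<-pos (y ^ℚ n) {{positive (^ℚ-pos (≤-<-trans 0≤x x<y) n)}} x<y ⟩
  y * y ^ℚ n  ∎

^ℚ-reflects-≤ : ∀ {x y} → 0ℚ ≤ y → ∀ n → x ^ℚ suc n ≤ y ^ℚ suc n → x ≤ y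
^ℚ-reflects-≤ {x} {y} 0≤y n xⁿ≤yⁿ with x ≤? y
... | yes x≤y = x≤y
... | no  x≰y = contradiction (<-≤-trans (^ℚ-mono-< 0≤y (≰⇒> x≰y) n) xⁿ≤yⁿ) (<-irrefl refl)

ℕ→ℚ-mkℚ : ∀ n → ℕ→ℚ n ≡ mkℚ (+ n) 0 (Coprimality.sym (1-coprimeTo n))
ℕ→ℚ-mkℚ n = normalize-coprime (Coprimality.sym (1-coprimeTo n))

ℕ→ℚ-suc : ∀ n → ℕ→ℚ (suc n) ≡ 1ℚ + ℕ→ℚ n
ℕ→ℚ-suc n = sym (begin-equality
  1ℚ + ℕ→ℚ n                           ≡⟨ cong (_+_ 1ℚ) (ℕ→ℚ-mkℚ n) ⟩
  (+ 1 ℤ.+ + n ℤ.* + 1) / 1            ≡⟨ cong (λ i → (+ 1 ℤ.+ i) / 1) (ℤ.*-identityʳ (+ n)) ⟩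
  ℕ→ℚ (suc n)                          ∎)

ℕ→ℚ-nonNeg : ∀ n → 0ℚ ≤ ℕ→ℚ n
ℕ→ℚ-nonNeg zero    = ≤-refl
ℕ→ℚ-nonNeg (suc n) = ≤-trans (+-nonNeg 0≤1 (ℕ→ℚ-nonNeg n)) (≤-reflexive (sym (ℕ→ℚ-suc n)))

1≤ℕ→ℚ-suc : ∀ n → 1ℚ ≤ ℕ→ℚ (suc n)
1≤ℕ→ℚ-suc n = ≤-by-gap (ℕ→ℚ n) (ℕ→ℚ-nonNeg n) (sym (ℕ→ℚ-suc n))

ℕ→ℚ-homo-+ : ∀ m n → ℕ→ℚ (m ℕ.+ n) ≡ ℕ→ℚ m + ℕ→ℚ n
ℕ→ℚ-homo-+ zero    n = sym (+-identityˡ (ℕ→ℚ n))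
ℕ→ℚ-homo-+ (suc m) n = begin-equality
  ℕ→ℚ (suc (m ℕ.+ n))         ≡⟨ ℕ→ℚ-suc (m ℕ.+ n) ⟩
  1ℚ + ℕ→ℚ (m ℕ.+ n)          ≡⟨ cong (_+_ 1ℚ) (ℕ→ℚ-homo-+ m n) ⟩
  1ℚ + (ℕ→ℚ m + ℕ→ℚ n)        ≡⟨ +-assoc 1ℚ (ℕ→ℚ m) (ℕ→ℚ n) ⟨
  (1ℚ + ℕ→ℚ m) + ℕ→ℚ n        ≡⟨ cong (_+ ℕ→ℚ n) (ℕ→ℚ-suc m) ⟨
  ℕ→ℚ (suc m) + ℕ→ℚ n         ∎

ℕ→ℚ-homo-* : ∀ m n → ℕ→ℚ (m ℕ.* n) ≡ ℕ→ℚ m * ℕ→ℚ n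
ℕ→ℚ-homo-* zero    n = sym (*-zeroˡ (ℕ→ℚ n))
ℕ→ℚ-homo-* (suc m) n = begin-equality
  ℕ→ℚ (n ℕ.+ m ℕ.* n)         ≡⟨ ℕ→ℚ-homo-+ n (m ℕ.* n) ⟩
  ℕ→ℚ n + ℕ→ℚ (m ℕ.* n)       ≡⟨ cong (_+_ (ℕ→ℚ n)) (ℕ→ℚ-homo-* m n) ⟩
  ℕ→ℚ n + ℕ→ℚ m * ℕ→ℚ n       ≡⟨ distrib (ℕ→ℚ m) (ℕ→ℚ n) ⟩
  (1ℚ + ℕ→ℚ m) * ℕ→ℚ n        ≡⟨ cong (_* ℕ→ℚ n) (ℕ→ℚ-suc m) ⟨
  ℕ→ℚ (suc m) * ℕ→ℚ n         ∎
  where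
  distrib : ∀ a b → b + a * b ≡ (1ℚ + a) * b
  distrib = solve-∀ ℚ-ring

archimedean : ∀ p → ∃[ n ] p ≤ ℕ→ℚ n
archimedean p@(mkℚ i d _) = ℤ.∣ i ∣ , ≤-trans (*≤* i*1≤∣i∣*[1+d]) (≤-reflexive (sym (ℕ→ℚ-mkℚ ℤ.∣ i ∣)))
  where
  i≤∣i∣ : ∀ i → i ℤ.≤ + ℤ.∣ i ∣
  i≤∣i∣ (+ n)    = ℤ.≤-refl
  i≤∣i∣ ℤ.-[1+ n ] = ℤ.-≤+
  i*1≤∣i∣*[1+d] : i ℤ.* + 1 ℤ.≤ + ℤ.∣ i ∣ ℤ.* + suc d
  i*1≤∣i∣*[1+d] = ℤ.≤-trans (ℤ.≤-reflexive (ℤ.*-identityʳ i)) (ℤ.≤-trans (i≤∣i∣ i)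
    (ℤ.≤-trans (ℤ.+≤+ (ℕ.m≤m*n ℤ.∣ i ∣ (suc d))) (ℤ.≤-reflexive (ℤ.pos-* ℤ.∣ i ∣ (suc d)))))

archimedean-* : ∀ p {r} → 0ℚ < r → ∃[ n ] p ≤ ℕ→ℚ n * r
archimedean-* p {r} 0<r =
  let n , p/r≤n = archimedean (p * (1/ r))
  in  n , (begin
    p                 ≡⟨ p/r*r≡p ⟨
    p * (1/ r) * r    ≤⟨ *-monoʳ-≤-0≤ (<⇒≤ 0<r) p/r≤n ⟩
    ℕ→ℚ n * r         ∎)
  where
  instance _ = pos⇒nonZero r {{positive 0<r}}
  p/r*r≡p : p * (1/ r) * r ≡ p
  p/r*r≡p = trans (*-assoc p (1/ r) r) (trans (cong (p *_) (*-inverseˡ r)) (*-identityʳ p))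

bernoulli : ∀ {e} → 0ℚ ≤ e → e ≤ 1ℚ → ∀ n → (1ℚ - e) ^ℚ n * (1ℚ + ℕ→ℚ n * e) ≤ 1ℚ
bernoulli {e} 0≤e e≤1 zero    = ≤-reflexive (base e)
  where
  base : ∀ e → 1ℚ * (1ℚ + 0ℚ * e) ≡ 1ℚ
  base = solve-∀ ℚ-ring
bernoulli {e} 0≤e e≤1 (suc n) = ≤-by-gap _
  (+-nonNeg (p≤q⇒0≤q-p (bernoulli 0≤e e≤1 n))
            (*-nonNeg (*-nonNeg (*-nonNeg (^ℚ-nonNeg (p≤q⇒0≤q-p e≤1) n) (+-nonNeg 0≤1 (ℕ→ℚ-nonNeg n))) 0≤e) 0≤e))
  (begin-equality
    (1ℚ - e) * W * (1ℚ + ℕ→ℚ (suc n) * e) + gap  ≡⟨ cong (λ ν′ → (1ℚ - e) * W * (1ℚ + ν′ * e) + gap) (ℕ→ℚ-suc n) ⟩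
    (1ℚ - e) * W * (1ℚ + (1ℚ + ν) * e) + gap     ≡⟨ expand e W ν ⟩
    1ℚ                                             ∎)
  where
  W = (1ℚ - e) ^ℚ n
  ν = ℕ→ℚ n
  gap = (1ℚ - W * (1ℚ + ν * e)) + W * (1ℚ + ν) * e * e
  expand : ∀ e W ν →
    (1ℚ - e) * W * (1ℚ + (1ℚ + ν) * e) + ((1ℚ - W * (1ℚ + ν * e)) + W * (1ℚ + ν) * e * e) ≡ 1ℚ
  expand = solve-∀ ℚ-ring

bernoulli-decay : ∀ {η δ} n → 0ℚ ≤ η → η ≤ 1ℚ → 0ℚ ≤ δ → 1ℚ ≤ ℕ→ℚ n * (η * δ) →
                  (1ℚ - η) ^ℚ n ≤ δ
bernoulli-decay {η} {δ} n 0≤η η≤1 0≤δ 1≤νηδ = begin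
  Z                          ≡⟨ *-identityʳ Z ⟨
  Z * 1ℚ                     ≤⟨ *-monoˡ-≤-0≤ (^ℚ-nonNeg (p≤q⇒0≤q-p η≤1) n) 1≤[1+νη]δ ⟩
  Z * ((1ℚ + ν * η) * δ)     ≡⟨ *-assoc Z (1ℚ + ν * η) δ ⟨
  Z * (1ℚ + ν * η) * δ       ≤⟨ *-monoʳ-≤-0≤ 0≤δ (bernoulli 0≤η η≤1 n) ⟩
  1ℚ * δ                     ≡⟨ *-identityˡ δ ⟩
  δ                          ∎
  where
  Z = (1ℚ - η) ^ℚ n
  ν = ℕ→ℚ n
  rearrange : ∀ ν η δ → ν * (η * δ) + δ ≡ (1ℚ + ν * η) * δ
  rearrange = solve-∀ ℚ-ring
  1≤[1+νη]δ : 1ℚ ≤ (1ℚ + ν * η) * δ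
  1≤[1+νη]δ = ≤-trans 1≤νηδ (≤-by-gap δ 0≤δ (rearrange ν η δ))

^ℚ-vanishes : ∀ {η δ} → 0ℚ < η → η ≤ 1ℚ → 0ℚ < δ → ∃[ n ] (1ℚ - η) ^ℚ n ≤ δ
^ℚ-vanishes 0<η η≤1 0<δ =
  let n , 1≤νηδ = archimedean-* 1ℚ (*-pos 0<η 0<δ)
  in  n , bernoulli-decay n (<⇒≤ 0<η) η≤1 (<⇒≤ 0<δ) 1≤νηδ

geometric-bracket : ∀ {q} → 0ℚ ≤ q → q ≤ ½ → ∀ L →
  ∃[ k ] (q ≤ ℕ→ℚ (suc L) * q ^ℚ k × ℕ→ℚ (suc L) * q ^ℚ k ≤ 1ℚ)
geometric-bracket q≥0 q≤½ zero    = 0 , ≤-trans q≤½ (≤ᵇ⇒≤ _) , ≤ᵇ⇒≤ _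
geometric-bracket {q} q≥0 q≤½ (suc L) with geometric-bracket q≥0 q≤½ L
... | k , q≤A , A≤1 with ≤-total (ℕ→ℚ (suc (suc L)) * q ^ℚ k) 1ℚ
... | inj₁ A′≤1 = k , ≤-trans q≤A A≤A′ , A′≤1
  where
  A≤A′ : ℕ→ℚ (suc L) * q ^ℚ k ≤ ℕ→ℚ (suc (suc L)) * q ^ℚ k
  A≤A′ rewrite ℕ→ℚ-suc (suc L) = ≤-by-gap (q ^ℚ k) (^ℚ-nonNeg q≥0 k) (add-one (ℕ→ℚ (suc L)) (q ^ℚ k))
    where
    add-one : ∀ a Q → a * Q + Q ≡ (1ℚ + a) * Q
    add-one = solve-∀ ℚ-ring
... | inj₂ 1≤A′ = suc k , q≤qA′ , qA′≤1
  where
  A  = ℕ→ℚ (suc L) * q ^ℚ k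
  A′ = ℕ→ℚ (suc (suc L)) * q ^ℚ k
  swap : ∀ a q Q → a * (q * Q) ≡ q * (a * Q)
  swap = solve-∀ ℚ-ring
  A′≤A+A : A′ ≤ A + A
  A′≤A+A rewrite ℕ→ℚ-suc (suc L) | ℕ→ℚ-suc L =
    ≤-by-gap (ℕ→ℚ L * q ^ℚ k) (*-nonNeg (ℕ→ℚ-nonNeg L) (^ℚ-nonNeg q≥0 k)) (double (ℕ→ℚ L) (q ^ℚ k))
    where
    double : ∀ l Q → (1ℚ + (1ℚ + l)) * Q + l * Q ≡ (1ℚ + l) * Q + (1ℚ + l) * Q
    double = solve-∀ ℚ-ring
  q≤qA′ : q ≤ ℕ→ℚ (suc (suc L)) * q ^ℚ suc k
  q≤qA′ = begin
    q                                    ≡⟨ *-identityʳ q ⟨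
    q * 1ℚ                               ≤⟨ *-monoˡ-≤-0≤ q≥0 1≤A′ ⟩
    q * A′                               ≡⟨ swap (ℕ→ℚ (suc (suc L))) q (q ^ℚ k) ⟨
    ℕ→ℚ (suc (suc L)) * q ^ℚ suc k       ∎
  qA′≤1 : ℕ→ℚ (suc (suc L)) * q ^ℚ suc k ≤ 1ℚ
  qA′≤1 = begin
    ℕ→ℚ (suc (suc L)) * q ^ℚ suc k       ≡⟨ swap (ℕ→ℚ (suc (suc L))) q (q ^ℚ k) ⟩
    q * A′                               ≤⟨ *-monoˡ-≤-0≤ q≥0 (≤-trans A′≤A+A (+-mono-≤ A≤1 A≤1)) ⟩
    q * (1ℚ + 1ℚ)                        ≤⟨ *-monoʳ-≤-0≤ 0≤2 q≤½ ⟩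
    ½ * (1ℚ + 1ℚ)                        ≡⟨⟩
    1ℚ                                   ∎

≤1+cube : ∀ {x} → 0ℚ ≤ x → x ≤ 1ℚ + x * x * x
≤1+cube {x} 0≤x with ≤-total x 1ℚ
... | inj₁ x≤1 = ≤-trans x≤1 (≤-by-gap (x * x * x) (*-nonNeg (*-nonNeg 0≤x 0≤x) 0≤x) refl)
... | inj₂ 1≤x = begin
  x                  ≡⟨ cube-form x ⟩
  1ℚ * 1ℚ * x        ≤⟨ *-monoʳ-≤-0≤ 0≤x (*-mono-≤-0≤ 0≤1 1≤x 0≤1 1≤x) ⟩
  x * x * x          ≤⟨ ≤-by-gap 1ℚ 0≤1 (+-comm (x * x * x) 1ℚ) ⟩
  1ℚ + x * x * x     ∎
  where
  cube-form : ∀ x → x ≡ 1ℚ * 1ℚ * x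
  cube-form = solve-∀ ℚ-ring

module _ {k} (Δ′ : PBPA k) (α : List (Fin k)) (Surv-antitone : ∀ m → Surv Δ′ (suc m) α ≤ Surv Δ′ m α) where

  ExpPartial≥n*Surv : ∀ N → ℕ→ℚ N * Surv Δ′ N α ≤ ExpPartial Δ′ α N
  ExpPartial≥n*Surv zero    = ≤-reflexive (*-zeroˡ (Surv Δ′ 0 α))
  ExpPartial≥n*Surv (suc N) = begin
    ℕ→ℚ (suc N) * S (suc N)     ≡⟨ cong (_* S (suc N)) (ℕ→ℚ-suc N) ⟩
    (1ℚ + ℕ→ℚ N) * S (suc N)    ≡⟨ distrib (ℕ→ℚ N) (S (suc N)) ⟩
    ℕ→ℚ N * S (suc N) + S (suc N)
      ≤⟨ +-mono-≤ (≤-trans (*-monoˡ-≤-0≤ (ℕ→ℚ-nonNeg N) (Surv-antitone N)) (ExpPartial≥n*Surv N))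
                  (Surv-antitone N) ⟩
    ExpPartial Δ′ α N + S N     ∎
    where
    S = λ m → Surv Δ′ m α
    distrib : ∀ ν s → (1ℚ + ν) * s ≡ ν * s + s
    distrib = solve-∀ ℚ-ring

  -- ExpPartial N ≥ N·S_N, and the tail bound makes (N·S_N)^P ≥ c^P·N^P/(N + 1), unbounded as P ≥ 2.
  ExpPartial-unbounded : (∀ m → 0ℚ ≤ Surv Δ′ m α) → ∀ {c} P → 2 ℕ.≤ P → 0ℚ < c →
    (∀ n → c ^ℚ P ≤ ℕ→ℚ (suc n) * (Surv Δ′ n α ^ℚ P)) →
    ∀ B → ∃[ N ] B ≤ ExpPartial Δ′ α N
  ExpPartial-unbounded Surv-nonNeg {c} P@(suc (suc P′)) 2≤P@(ℕ.s≤s (ℕ.s≤s _)) 0<c tail B with ≤-total B 0ℚ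
  ... | inj₁ B≤0 = 0 , B≤0
  ... | inj₂ 0≤B =
    let n , 2Bᴾ≤νCᴾ = archimedean-* ((1ℚ + 1ℚ) * B ^ℚ P) (^ℚ-pos 0<c P)
    in  suc n , ≤-trans (B≤N*S n 2Bᴾ≤νCᴾ) (ExpPartial≥n*Surv (suc n))
    where
    B≤N*S : ∀ n → (1ℚ + 1ℚ) * B ^ℚ P ≤ ℕ→ℚ n * c ^ℚ P → B ≤ ℕ→ℚ (suc n) * Surv Δ′ (suc n) α
    B≤N*S n 2Bᴾ≤νCᴾ = ^ℚ-reflects-≤ (*-nonNeg 0≤N (Surv-nonNeg (suc n))) (suc P′)
      (*-cancelˡ-≤-pos M {{positive (<-≤-trans 0<1 (1≤ℕ→ℚ-suc (suc n)))}} (begin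
        M * B ^ℚ P                      ≤⟨ M*Bᴾ≤N*2Bᴾ ⟩
        N * ((1ℚ + 1ℚ) * B ^ℚ P)        ≤⟨ *-monoˡ-≤-0≤ 0≤N 2Bᴾ≤νCᴾ ⟩
        N * (ℕ→ℚ n * C)                 ≤⟨ *-monoˡ-≤-0≤ 0≤N (*-monoʳ-≤-0≤ 0≤C ν≤N) ⟩
        N * (N * C)                     ≡⟨ square N C ⟩
        N ^ℚ 2 * C                      ≤⟨ *-monoʳ-≤-0≤ 0≤C (^ℚ-monoʳ-≤ (1≤ℕ→ℚ-suc n) 2≤P) ⟩
        N ^ℚ P * C                      ≤⟨ *-monoˡ-≤-0≤ (^ℚ-nonNeg 0≤N P) (tail (suc n)) ⟩
        N ^ℚ P * (M * S ^ℚ P)           ≡⟨ swap (N ^ℚ P) M (S ^ℚ P) ⟩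
        M * (N ^ℚ P * S ^ℚ P)           ≡⟨ cong (M *_) (^ℚ-distrib-* N S P) ⟨
        M * (N * S) ^ℚ P                ∎))
      where
      N = ℕ→ℚ (suc n)
      M = ℕ→ℚ (suc (suc n))
      S = Surv Δ′ (suc n) α
      C = c ^ℚ P
      0≤N : 0ℚ ≤ N
      0≤N = ℕ→ℚ-nonNeg (suc n)
      0≤C : 0ℚ ≤ C
      0≤C = ^ℚ-nonNeg (<⇒≤ 0<c) P
      ν≤N : ℕ→ℚ n ≤ N
      ν≤N = ≤-by-gap 1ℚ 0≤1 (trans (+-comm (ℕ→ℚ n) 1ℚ) (sym (ℕ→ℚ-suc n)))
      square : ∀ N C → N * (N * C) ≡ N * (N * 1ℚ) * C
      square = solve-∀ ℚ-ring
      swap : ∀ x y z → x * (y * z) ≡ y * (x * z)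
      swap = solve-∀ ℚ-ring
      M*Bᴾ≤N*2Bᴾ : M * B ^ℚ P ≤ N * ((1ℚ + 1ℚ) * B ^ℚ P)
      M*Bᴾ≤N*2Bᴾ rewrite ℕ→ℚ-suc (suc n) | ℕ→ℚ-suc n =
        ≤-by-gap (ℕ→ℚ n * B ^ℚ P) (*-nonNeg (ℕ→ℚ-nonNeg n) (^ℚ-nonNeg 0≤B P)) (regroup (ℕ→ℚ n) (B ^ℚ P))
        where
        regroup : ∀ ν b → (1ℚ + (1ℚ + ν)) * b + ν * b ≡ (1ℚ + ν) * ((1ℚ + 1ℚ) * b)
        regroup = solve-∀ ℚ-ring

module SquaringWeights (u : ℚ) where

  -- In an alphabet of size n, weight X_i = u^(2^(n−i)): one level down squares the weight.
  weight : ∀ {n} → Fin n → ℚ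
  weight {suc n} zero    = u ^ℚ (2 ^ n)
  weight {suc n} (suc j) = weight {n} j

  weight-inject₁ : ∀ {n} (j : Fin n) → weight (inject₁ j) ≡ weight j * weight j
  weight-inject₁ {suc n} zero    = ^ℚ-2^-suc u n
  weight-inject₁ {suc n} (suc j) = weight-inject₁ j

  weight-fromℕ : ∀ n → weight (fromℕ n) ≡ u
  weight-fromℕ zero    = *-identityʳ u
  weight-fromℕ (suc n) = weight-fromℕ n

  module _ (0≤u : 0ℚ ≤ u) (u≤½ : u ≤ ½) where

    u≤1 : u ≤ 1ℚ
    u≤1 = ≤-trans u≤½ ½≤1

    weight-nonNeg : ∀ {n} (X : Fin n) → 0ℚ ≤ weight X
    weight-nonNeg {suc n} zero    = ^ℚ-nonNeg 0≤u (2 ^ n)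
    weight-nonNeg {suc n} (suc j) = weight-nonNeg j

    weight-≤½ : ∀ {n} (X : Fin n) → weight X ≤ ½
    weight-≤½ {suc n} zero    = begin
      u ^ℚ (2 ^ n)  ≤⟨ ^ℚ-antitoneʳ 0≤u u≤1 (ℕ.m^n>0 2 n) ⟩
      u * 1ℚ        ≡⟨ *-identityʳ u ⟩
      u             ≤⟨ u≤½ ⟩
      ½             ∎
    weight-≤½ {suc n} (suc j) = weight-≤½ j

    u^2^n≤weight² : ∀ {n} (X : Fin n) → u ^ℚ (2 ^ n) ≤ weight X * weight X
    u^2^n≤weight² {suc n} zero    = ≤-reflexive (^ℚ-2^-suc u n)
    u^2^n≤weight² {suc n} (suc j) =
      ≤-trans (^ℚ-antitoneʳ 0≤u u≤1 (ℕ.^-monoʳ-≤ 2 (ℕ.n≤1+n n))) (u^2^n≤weight² j)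

module Δ-Survival (h' : ℕ) where

  S : ℕ → List (Fin (suc h')) → ℚ
  S = Surv (Δ h')

  Term : ℕ → List (Fin (suc h')) → ℚ
  Term m α = 1ℚ - S m α

  X₁ : Fin (suc h')
  X₁ = zero

  descend : Fin (suc h') → List (Fin (suc h')) → List (Fin (suc h'))
  descend zero    β = β
  descend (suc j) β = inject₁ j ∷ β

  descend-++ : ∀ X α β → descend X (α ++ β) ≡ descend X α ++ β
  descend-++ zero    α β = refl
  descend-++ (suc j) α β = refl

  Surv-step : ∀ m X β → S (suc m) (X ∷ β) ≡ ½ * S m (X ∷ X ∷ β) + ½ * S m (descend X β)
  Surv-step m zero    β = cong (_+_ (½ * S m (zero ∷ zero ∷ β))) (+-identityʳ _)
  Surv-step m (suc j) β = cong (_+_ (½ * S m (suc j ∷ suc j ∷ β))) (+-identityʳ _)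

  Surv-[] : ∀ m → S m [] ≡ 0ℚ
  Surv-[] zero    = refl
  Surv-[] (suc m) = refl

  Surv-nonNeg : ∀ m α → 0ℚ ≤ S m α
  Surv-nonNeg zero    []      = ≤-refl
  Surv-nonNeg zero    (X ∷ β) = 0≤1
  Surv-nonNeg (suc m) []      = ≤-refl
  Surv-nonNeg (suc m) (X ∷ β) = begin
    0ℚ                                          ≡⟨⟩
    ½ * 0ℚ + ½ * 0ℚ                             ≤⟨ ½-average-mono-≤ (Surv-nonNeg m _) (Surv-nonNeg m _) ⟩
    ½ * S m (X ∷ X ∷ β) + ½ * S m (descend X β) ≡⟨ Surv-step m X β ⟨
    S (suc m) (X ∷ β)                           ∎

  Surv-≤1 : ∀ m α → S m α ≤ 1ℚ
  Surv-≤1 zero    []      = 0≤1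
  Surv-≤1 zero    (X ∷ β) = ≤-refl
  Surv-≤1 (suc m) []      = 0≤1
  Surv-≤1 (suc m) (X ∷ β) = begin
    S (suc m) (X ∷ β)                           ≡⟨ Surv-step m X β ⟩
    ½ * S m (X ∷ X ∷ β) + ½ * S m (descend X β) ≤⟨ ½-average-mono-≤ (Surv-≤1 m _) (Surv-≤1 m _) ⟩
    ½ * 1ℚ + ½ * 1ℚ                             ≡⟨⟩
    1ℚ                                          ∎

  Surv-antitone : ∀ m α → S (suc m) α ≤ S m α
  Surv-antitone zero    []      = ≤-refl
  Surv-antitone zero    (X ∷ β) = Surv-≤1 1 (X ∷ β)
  Surv-antitone (suc m) []      = ≤-refl
  Surv-antitone (suc m) (X ∷ β) = begin
    S (suc (suc m)) (X ∷ β)                               ≡⟨ Surv-step (suc m) X β ⟩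
    ½ * S (suc m) (X ∷ X ∷ β) + ½ * S (suc m) (descend X β)
      ≤⟨ ½-average-mono-≤ (Surv-antitone m _) (Surv-antitone m _) ⟩
    ½ * S m (X ∷ X ∷ β) + ½ * S m (descend X β)           ≡⟨ Surv-step m X β ⟨
    S (suc m) (X ∷ β)                                     ∎

  Term-step : ∀ m X β → Term (suc m) (X ∷ β) ≡ ½ * Term m (X ∷ X ∷ β) + ½ * Term m (descend X β)
  Term-step m X β = trans (cong (_-_ 1ℚ) (Surv-step m X β)) (complement (S m (X ∷ X ∷ β)) (S m (descend X β)))
    where
    complement : ∀ a b → 1ℚ - (½ * a + ½ * b) ≡ ½ * (1ℚ - a) + ½ * (1ℚ - b)
    complement = solve-∀ ℚ-ring

  Term-nonNeg : ∀ m α → 0ℚ ≤ Term m α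
  Term-nonNeg m α = p≤q⇒0≤q-p (Surv-≤1 m α)

  Term-mono : ∀ m α → Term m α ≤ Term (suc m) α
  Term-mono m α = 1-‿antimono-≤ (Surv-antitone m α)

  Term-++ : ∀ m α β → Term m (α ++ β) ≤ Term m α * Term m β
  Term-++ zero    []      β = ≤-reflexive (sym (*-identityˡ _))
  Term-++ (suc m) []      β = ≤-reflexive (sym (*-identityˡ _))
  Term-++ zero    (X ∷ α) β = ≤-reflexive (sym (*-zeroˡ (Term zero β)))
  Term-++ (suc m) (X ∷ α) β = begin
    Term (suc m) (X ∷ α ++ β)
      ≡⟨ Term-step m X (α ++ β) ⟩
    ½ * Term m (X ∷ X ∷ α ++ β) + ½ * Term m (descend X (α ++ β))
      ≤⟨ ½-average-mono-≤ (Term-++ m (X ∷ X ∷ α) β)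
                          (subst (λ γ → Term m γ ≤ Term m (descend X α) * Term m β) (sym (descend-++ X α β)) (Term-++ m (descend X α) β)) ⟩
    ½ * (Term m (X ∷ X ∷ α) * Term m β) + ½ * (Term m (descend X α) * Term m β)
      ≡⟨ factor (Term m (X ∷ X ∷ α)) (Term m (descend X α)) (Term m β) ⟩
    (½ * Term m (X ∷ X ∷ α) + ½ * Term m (descend X α)) * Term m β
      ≡⟨ cong (_* Term m β) (Term-step m X α) ⟨
    Term (suc m) (X ∷ α) * Term m β
      ≤⟨ *-monoˡ-≤-0≤ (Term-nonNeg (suc m) (X ∷ α)) (Term-mono m β) ⟩
    Term (suc m) (X ∷ α) * Term (suc m) β
      ∎
    where
    factor : ∀ a b c → ½ * (a * c) + ½ * (b * c) ≡ (½ * a + ½ * b) * c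
    factor = solve-∀ ℚ-ring

  X₁^ : ℕ → List (Fin (suc h'))
  X₁^ k = replicate k X₁

  -- The error term a³(k³ + 3mk) absorbs the convexity ½((k+1)³ + (k−1)³) = k³ + 3k of the cube.
  Surv-X₁^-lower : ∀ {a} → 0ℚ ≤ a → ∀ m k →
    ℕ→ℚ k * a ≤ S m (X₁^ k) + a * a * a * (ℕ→ℚ k * ℕ→ℚ k * ℕ→ℚ k + ℕ→ℚ 3 * ℕ→ℚ m * ℕ→ℚ k)
  Surv-X₁^-lower {a} 0≤a m zero = begin
    0ℚ * a                                                  ≡⟨ *-zeroˡ a ⟩
    0ℚ                                                      ≡⟨ vanish a (ℕ→ℚ m) ⟨
    0ℚ + a * a * a * (0ℚ * 0ℚ * 0ℚ + ℕ→ℚ 3 * ℕ→ℚ m * 0ℚ)    ≡⟨ cong (_+ _) (Surv-[] m) ⟨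
    S m [] + a * a * a * (0ℚ * 0ℚ * 0ℚ + ℕ→ℚ 3 * ℕ→ℚ m * 0ℚ) ∎
    where
    vanish : ∀ a μ → 0ℚ + a * a * a * (0ℚ * 0ℚ * 0ℚ + ℕ→ℚ 3 * μ * 0ℚ) ≡ 0ℚ
    vanish = solve-∀ ℚ-ring
  Surv-X₁^-lower {a} 0≤a zero (suc k) = begin
    K * a                               ≤⟨ ≤1+cube (*-nonNeg (ℕ→ℚ-nonNeg (suc k)) 0≤a) ⟩
    1ℚ + K * a * (K * a) * (K * a)      ≡⟨ cube (ℕ→ℚ (suc k)) a ⟩
    1ℚ + a * a * a * (K * K * K + ℕ→ℚ 3 * 0ℚ * K) ∎
    where
    K = ℕ→ℚ (suc k)
    cube : ∀ K a → 1ℚ + K * a * (K * a) * (K * a) ≡ 1ℚ + a * a * a * (K * K * K + ℕ→ℚ 3 * 0ℚ * K)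
    cube = solve-∀ ℚ-ring
  Surv-X₁^-lower {a} 0≤a (suc m) (suc k) = begin
    ℕ→ℚ (suc k) * a
      ≡⟨ midpoint ⟩
    ½ * (ℕ→ℚ (suc (suc k)) * a) + ½ * (ℕ→ℚ k * a)
      ≤⟨ ½-average-mono-≤ (Surv-X₁^-lower 0≤a m (suc (suc k))) (Surv-X₁^-lower 0≤a m k) ⟩
    ½ * (S m (X₁^ (2 ℕ.+ k)) + a * a * a * R₊) + ½ * (S m (X₁^ k) + a * a * a * R₋)
      ≡⟨ regroup ⟩
    (½ * S m (X₁^ (2 ℕ.+ k)) + ½ * S m (X₁^ k)) + a * a * a * R
      ≡⟨ cong (_+ a * a * a * R) (Surv-step m X₁ (X₁^ k)) ⟨
    S (suc m) (X₁^ (suc k)) + a * a * a * R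
      ∎
    where
    R₊ = ℕ→ℚ (suc (suc k)) * ℕ→ℚ (suc (suc k)) * ℕ→ℚ (suc (suc k)) + ℕ→ℚ 3 * ℕ→ℚ m * ℕ→ℚ (suc (suc k))
    R₋ = ℕ→ℚ k * ℕ→ℚ k * ℕ→ℚ k + ℕ→ℚ 3 * ℕ→ℚ m * ℕ→ℚ k
    R  = ℕ→ℚ (suc k) * ℕ→ℚ (suc k) * ℕ→ℚ (suc k) + ℕ→ℚ 3 * ℕ→ℚ (suc m) * ℕ→ℚ (suc k)
    midpoint : ℕ→ℚ (suc k) * a ≡ ½ * (ℕ→ℚ (suc (suc k)) * a) + ½ * (ℕ→ℚ k * a)
    midpoint rewrite ℕ→ℚ-suc (suc k) | ℕ→ℚ-suc k = identity (ℕ→ℚ k) a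
      where
      identity : ∀ κ a → (1ℚ + κ) * a ≡ ½ * ((1ℚ + (1ℚ + κ)) * a) + ½ * (κ * a)
      identity = solve-∀ ℚ-ring
    regroup : ½ * (S m (X₁^ (2 ℕ.+ k)) + a * a * a * R₊) + ½ * (S m (X₁^ k) + a * a * a * R₋)
            ≡ (½ * S m (X₁^ (2 ℕ.+ k)) + ½ * S m (X₁^ k)) + a * a * a * R
    regroup rewrite ℕ→ℚ-suc (suc k) | ℕ→ℚ-suc k | ℕ→ℚ-suc m =
      identity (S m (X₁^ (2 ℕ.+ k))) (S m (X₁^ k)) a (ℕ→ℚ k) (ℕ→ℚ m)
      where
      identity : ∀ s₊ s₋ a κ μ →
        ½ * (s₊ + a * a * a * ((1ℚ + (1ℚ + κ)) * (1ℚ + (1ℚ + κ)) * (1ℚ + (1ℚ + κ)) + ℕ→ℚ 3 * μ * (1ℚ + (1ℚ + κ))))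
          + ½ * (s₋ + a * a * a * (κ * κ * κ + ℕ→ℚ 3 * μ * κ))
        ≡ (½ * s₊ + ½ * s₋) + a * a * a * ((1ℚ + κ) * (1ℚ + κ) * (1ℚ + κ) + ℕ→ℚ 3 * (1ℚ + μ) * (1ℚ + κ))
      identity = solve-∀ ℚ-ring

  Surv-X₁-lower : ∀ {τ} M → 0ℚ ≤ τ → ℕ→ℚ (8 ℕ.* suc (3 ℕ.* M)) * (τ * τ) ≤ 1ℚ → τ ≤ S M (X₁ ∷ [])
  Surv-X₁-lower {τ} M 0≤τ small = begin
    τ                    ≡⟨ cancel τ τ ⟨
    τ + τ - τ            ≤⟨ +-monoˡ-≤ (- τ) 2τ≤S+τ ⟩
    S M (X₁ ∷ []) + τ - τ ≡⟨ cancel (S M (X₁ ∷ [])) τ ⟩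
    S M (X₁ ∷ [])        ∎
    where
    a = (1ℚ + 1ℚ) * τ
    μ = ℕ→ℚ M
    cancel : ∀ x y → x + y - y ≡ x
    cancel = solve-∀ ℚ-ring
    cast : ℕ→ℚ (8 ℕ.* suc (3 ℕ.* M)) ≡ ℕ→ℚ 8 * (1ℚ + ℕ→ℚ 3 * μ)
    cast = trans (ℕ→ℚ-homo-* 8 (suc (3 ℕ.* M)))
                 (cong (ℕ→ℚ 8 *_) (trans (ℕ→ℚ-suc (3 ℕ.* M)) (cong (_+_ 1ℚ) (ℕ→ℚ-homo-* 3 M))))
    cubic≤τ : a * a * a * (ℕ→ℚ 1 * ℕ→ℚ 1 * ℕ→ℚ 1 + ℕ→ℚ 3 * μ * ℕ→ℚ 1) ≤ τ
    cubic≤τ = begin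
      a * a * a * (ℕ→ℚ 1 * ℕ→ℚ 1 * ℕ→ℚ 1 + ℕ→ℚ 3 * μ * ℕ→ℚ 1) ≡⟨ expand τ μ ⟩
      τ * (ℕ→ℚ 8 * (1ℚ + ℕ→ℚ 3 * μ) * (τ * τ))               ≡⟨ cong (λ c → τ * (c * (τ * τ))) cast ⟨
      τ * (ℕ→ℚ (8 ℕ.* suc (3 ℕ.* M)) * (τ * τ))              ≤⟨ *-monoˡ-≤-0≤ 0≤τ small ⟩
      τ * 1ℚ                                                 ≡⟨ *-identityʳ τ ⟩
      τ                                                      ∎
      where
      expand : ∀ τ μ → (1ℚ + 1ℚ) * τ * ((1ℚ + 1ℚ) * τ) * ((1ℚ + 1ℚ) * τ) * (ℕ→ℚ 1 * ℕ→ℚ 1 * ℕ→ℚ 1 + ℕ→ℚ 3 * μ * ℕ→ℚ 1)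
                     ≡ τ * (ℕ→ℚ 8 * (1ℚ + ℕ→ℚ 3 * μ) * (τ * τ))
      expand = solve-∀ ℚ-ring
    2τ≤S+τ : τ + τ ≤ S M (X₁ ∷ []) + τ
    2τ≤S+τ = begin
      τ + τ               ≡⟨ double τ ⟩
      ℕ→ℚ 1 * a           ≤⟨ Surv-X₁^-lower {a} (*-nonNeg 0≤2 0≤τ) M 1 ⟩
      S M (X₁ ∷ []) + a * a * a * (ℕ→ℚ 1 * ℕ→ℚ 1 * ℕ→ℚ 1 + ℕ→ℚ 3 * μ * ℕ→ℚ 1)
                          ≤⟨ +-monoʳ-≤ (S M (X₁ ∷ [])) cubic≤τ ⟩
      S M (X₁ ∷ []) + τ   ∎
      where
      double : ∀ τ → τ + τ ≡ ℕ→ℚ 1 * ((1ℚ + 1ℚ) * τ)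
      double = solve-∀ ℚ-ring

  -- 1 − t is the least fixed point of r ↦ ½ r² + ½ (1 − t²), the termination equation of X_(i+1)
  -- when X_i terminates with probability at most 1 − t².
  Term-stack-bound : ∀ (i : Fin h') {t} → 0ℚ ≤ t → t ≤ 1ℚ → ∀ m → t * t ≤ S m (inject₁ i ∷ []) →
                     ∀ n → Term m (replicate n (suc i)) ≤ (1ℚ - t) ^ℚ n
  Term-stack-bound i {t} 0≤t t≤1 m       t²≤S zero    = ≤-reflexive (cong (_-_ 1ℚ) (Surv-[] m))
  Term-stack-bound i {t} 0≤t t≤1 zero    t²≤S (suc n) = ^ℚ-nonNeg (p≤q⇒0≤q-p t≤1) (suc n)
  Term-stack-bound i {t} 0≤t t≤1 (suc m) t²≤S (suc n) = begin
    Term (suc m) (Y ∷ Yⁿ)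
      ≡⟨ Term-step m (suc i) Yⁿ ⟩
    ½ * Term m (Y ∷ Y ∷ Yⁿ) + ½ * Term m (inject₁ i ∷ Yⁿ)
      ≤⟨ ½-average-mono-≤ (bound (suc (suc n))) (Term-++ m (inject₁ i ∷ []) Yⁿ) ⟩
    ½ * r ^ℚ suc (suc n) + ½ * (Term m (inject₁ i ∷ []) * Term m Yⁿ)
      ≤⟨ +-monoʳ-≤ (½ * r ^ℚ suc (suc n)) (*-monoˡ-≤-0≤ 0≤½
           (*-mono-≤-0≤ (Term-nonNeg m _) (1-‿antimono-≤ t²≤Sₘ) (Term-nonNeg m Yⁿ) (bound n))) ⟩
    ½ * r ^ℚ suc (suc n) + ½ * ((1ℚ - t * t) * r ^ℚ n)
      ≡⟨ collapse t (r ^ℚ n) ⟩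
    r ^ℚ suc n
      ∎
    where
    Y  = suc i
    Yⁿ = replicate n Y
    r  = 1ℚ - t
    t²≤Sₘ : t * t ≤ S m (inject₁ i ∷ [])
    t²≤Sₘ = ≤-trans t²≤S (Surv-antitone m (inject₁ i ∷ []))
    bound : ∀ n → Term m (replicate n Y) ≤ r ^ℚ n
    bound = Term-stack-bound i 0≤t t≤1 m t²≤Sₘ
    collapse : ∀ t R → ½ * ((1ℚ - t) * ((1ℚ - t) * R)) + ½ * ((1ℚ - t * t) * R) ≡ (1ℚ - t) * R
    collapse = solve-∀ ℚ-ring

  Surv-lift : ∀ (i : Fin h') {t} → 0ℚ ≤ t → t ≤ 1ℚ → ∀ M → t * t ≤ S M (inject₁ i ∷ []) → t ≤ S M (suc i ∷ [])
  Surv-lift i {t} 0≤t t≤1 M t²≤S = 1-‿cancel-≤ (begin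
    Term M (suc i ∷ [])   ≤⟨ Term-stack-bound i 0≤t t≤1 M t²≤S 1 ⟩
    (1ℚ - t) * 1ℚ         ≡⟨ *-identityʳ (1ℚ - t) ⟩
    1ℚ - t                ∎)

  Surv-level-lower : ∀ M X {t} → 0ℚ ≤ t → t ≤ 1ℚ → t ^ℚ (2 ^ toℕ X) ≤ S M (X₁ ∷ []) → t ≤ S M (X ∷ [])
  Surv-level-lower M = <-weakInduction P base step
    where
    P : Fin (suc h') → Set
    P X = ∀ {t} → 0ℚ ≤ t → t ≤ 1ℚ → t ^ℚ (2 ^ toℕ X) ≤ S M (X₁ ∷ []) → t ≤ S M (X ∷ [])
    base : P zero
    base {t} _ _ t¹≤S = ≤-trans (≤-reflexive (sym (*-identityʳ t))) t¹≤S
    step : ∀ i → P (inject₁ i) → P (suc i)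
    step i IH {t} 0≤t t≤1 t^2^[1+i]≤S = Surv-lift i 0≤t t≤1 M (IH (*-nonNeg 0≤t 0≤t) (*-mono-≤-0≤ 0≤t t≤1 0≤t t≤1)
      (≤-trans (≤-reflexive squared) t^2^[1+i]≤S))
      where
      squared : (t * t) ^ℚ (2 ^ toℕ (inject₁ i)) ≡ t ^ℚ (2 ^ suc (toℕ i))
      squared rewrite toℕ-inject₁ i = trans (^ℚ-distrib-* t t (2 ^ toℕ i)) (sym (^ℚ-2^-suc t (toℕ i)))

  -- With q = 2^(−P) and L = 8(1 + 3M), pick k with q ≤ L·qᵏ ≤ 1. Then τ = (2^(−k))^(2^h') has L·τ² ≤ 1,
  -- so 2^(−k) ≤ S M [X_h], while (2^(−k))^P = qᵏ ≥ q/L.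
  Surv-top-tail : ∀ M → (½ ^ℚ 4) ^ℚ (2 ^ suc h') ≤ ℕ→ℚ (suc M) * (S M (Xtop h' ∷ []) ^ℚ (2 ^ suc h'))
  Surv-top-tail M =
    -- suc (3M + 7·suc(3M)) is 8·suc(3M) by computation.
    let k , q≤Lqᵏ , Lqᵏ≤1 = geometric-bracket (^ℚ-nonNeg 0≤½ P) q≤½ (3 ℕ.* M ℕ.+ 7 ℕ.* suc (3 ℕ.* M))
    in  tail-from-bracket k q≤Lqᵏ Lqᵏ≤1
    where
    P = 2 ^ suc h'
    q = ½ ^ℚ P
    L = ℕ→ℚ (8 ℕ.* suc (3 ℕ.* M))
    Sₕ = S M (Xtop h' ∷ [])
    2≤P : 2 ℕ.≤ P
    2≤P = 2≤2^[1+n] h'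
    q≤½ : q ≤ ½
    q≤½ = ≤-trans (^ℚ-antitoneʳ 0≤½ ½≤1 (ℕ.≤-trans (ℕ.n≤1+n 1) 2≤P)) (≤-reflexive (*-identityʳ ½))
    5+P≤4P : 5 ℕ.+ P ℕ.≤ 4 ℕ.* P
    5+P≤4P = ℕ.≤-trans (ℕ.≤-reflexive (ℕ.+-comm 5 P)) (ℕ.+-monoʳ-≤ P (ℕ.≤-trans (ℕ.n≤1+n 5) (ℕ.*-monoʳ-≤ 3 2≤P)))
    cᴾ≤q/32 : (½ ^ℚ 4) ^ℚ P ≤ ½ ^ℚ 5 * q
    cᴾ≤q/32 = begin
      (½ ^ℚ 4) ^ℚ P     ≡⟨ ^ℚ-assocʳ ½ 4 P ⟩
      ½ ^ℚ (4 ℕ.* P)    ≤⟨ ^ℚ-antitoneʳ 0≤½ ½≤1 5+P≤4P ⟩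
      ½ ^ℚ (5 ℕ.+ P)    ≡⟨ ^ℚ-homo-+ ½ 5 P ⟩
      ½ ^ℚ 5 * q        ∎
    L/32≤1+M : ½ ^ℚ 5 * L ≤ ℕ→ℚ (suc M)
    L/32≤1+M = ≤-by-gap (½ * ½ * (1ℚ + 1ℚ + 1ℚ + μ)) (*-nonNeg {½ * ½} (≤ᵇ⇒≤ _) (+-nonNeg {1ℚ + 1ℚ + 1ℚ} (≤ᵇ⇒≤ _) (ℕ→ℚ-nonNeg M)))
      (begin-equality
        ½ ^ℚ 5 * L + ½ * ½ * (1ℚ + 1ℚ + 1ℚ + μ)
          ≡⟨ cong (λ l → ½ ^ℚ 5 * l + ½ * ½ * (1ℚ + 1ℚ + 1ℚ + μ)) cast ⟩
        ½ ^ℚ 5 * (ℕ→ℚ 8 * (1ℚ + ℕ→ℚ 3 * μ)) + ½ * ½ * (1ℚ + 1ℚ + 1ℚ + μ)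
          ≡⟨ identity μ ⟩
        1ℚ + μ
          ≡⟨ ℕ→ℚ-suc M ⟨
        ℕ→ℚ (suc M) ∎)
      where
      μ = ℕ→ℚ M
      cast : L ≡ ℕ→ℚ 8 * (1ℚ + ℕ→ℚ 3 * μ)
      cast = trans (ℕ→ℚ-homo-* 8 (suc (3 ℕ.* M)))
                   (cong (ℕ→ℚ 8 *_) (trans (ℕ→ℚ-suc (3 ℕ.* M)) (cong (_+_ 1ℚ) (ℕ→ℚ-homo-* 3 M))))
      identity : ∀ μ → ½ ^ℚ 5 * (ℕ→ℚ 8 * (1ℚ + ℕ→ℚ 3 * μ)) + ½ * ½ * (1ℚ + 1ℚ + 1ℚ + μ) ≡ 1ℚ + μ
      identity = solve-∀ ℚ-ring
    tail-from-bracket : ∀ k → q ≤ L * q ^ℚ k → L * q ^ℚ k ≤ 1ℚ →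
                        (½ ^ℚ 4) ^ℚ P ≤ ℕ→ℚ (suc M) * (Sₕ ^ℚ P)
    tail-from-bracket k q≤Lqᵏ Lqᵏ≤1 = begin
      (½ ^ℚ 4) ^ℚ P                ≤⟨ cᴾ≤q/32 ⟩
      ½ ^ℚ 5 * q                   ≤⟨ *-monoˡ-≤-0≤ (^ℚ-nonNeg 0≤½ 5) q≤Lqᵏ ⟩
      ½ ^ℚ 5 * (L * q ^ℚ k)        ≡⟨ *-assoc (½ ^ℚ 5) L (q ^ℚ k) ⟨
      ½ ^ℚ 5 * L * q ^ℚ k          ≤⟨ *-monoʳ-≤-0≤ (^ℚ-nonNeg (^ℚ-nonNeg 0≤½ P) k) L/32≤1+M ⟩
      ℕ→ℚ (suc M) * q ^ℚ k         ≤⟨ *-monoˡ-≤-0≤ (ℕ→ℚ-nonNeg (suc M)) qᵏ≤Sₕᴾ ⟩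
      ℕ→ℚ (suc M) * (Sₕ ^ℚ P)      ∎
      where
      t = ½ ^ℚ k
      τ = t ^ℚ (2 ^ h')
      0≤t : 0ℚ ≤ t
      0≤t = ^ℚ-nonNeg 0≤½ k
      tᴾ≡qᵏ : t ^ℚ P ≡ q ^ℚ k
      tᴾ≡qᵏ = begin-equality
        (½ ^ℚ k) ^ℚ P   ≡⟨ ^ℚ-assocʳ ½ k P ⟩
        ½ ^ℚ (k ℕ.* P)  ≡⟨ cong (½ ^ℚ_) (ℕ.*-comm k P) ⟩
        ½ ^ℚ (P ℕ.* k)  ≡⟨ ^ℚ-assocʳ ½ P k ⟨
        q ^ℚ k          ∎
      τ²≡qᵏ : τ * τ ≡ q ^ℚ k
      τ²≡qᵏ = trans (sym (^ℚ-2^-suc t h')) tᴾ≡qᵏ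
      τ≤S₁ : τ ≤ S M (X₁ ∷ [])
      τ≤S₁ = Surv-X₁-lower M (^ℚ-nonNeg 0≤t (2 ^ h'))
        (≤-trans (≤-reflexive (cong (L *_) τ²≡qᵏ)) Lqᵏ≤1)
      t≤Sₕ : t ≤ Sₕ
      t≤Sₕ = Surv-level-lower M (Xtop h') 0≤t (^ℚ-≤1 0≤½ ½≤1 k)
        (subst (λ e → t ^ℚ (2 ^ e) ≤ S M (X₁ ∷ [])) (sym (toℕ-fromℕ h')) τ≤S₁)
      qᵏ≤Sₕᴾ : q ^ℚ k ≤ Sₕ ^ℚ P
      qᵏ≤Sₕᴾ = ≤-trans (≤-reflexive (sym tᴾ≡qᵏ)) (^ℚ-mono-≤ 0≤t t≤Sₕ P)

  module _ {u} (0≤u : 0ℚ ≤ u) (u≤½ : u ≤ ½) where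
    open SquaringWeights u

    η : ℚ
    η = u ^ℚ (2 ^ suc h')

    z : ℚ
    z = 1ℚ - η

    s : Fin (suc h') → ℚ
    s X = 1ℚ - (1ℚ + 1ℚ) * weight X

    potential : List (Fin (suc h')) → ℚ
    potential []      = 1ℚ
    potential (X ∷ β) = s X * potential β

    s-nonNeg : ∀ X → 0ℚ ≤ s X
    s-nonNeg X = p≤q⇒0≤q-p (*-monoˡ-≤-0≤ 0≤2 (weight-≤½ 0≤u u≤½ X))

    s-≤1 : ∀ X → s X ≤ 1ℚ
    s-≤1 X = ≤-by-gap ((1ℚ + 1ℚ) * weight X) (*-nonNeg 0≤2 (weight-nonNeg 0≤u u≤½ X))
                      (restore (weight X))
      where
      restore : ∀ w → 1ℚ - (1ℚ + 1ℚ) * w + (1ℚ + 1ℚ) * w ≡ 1ℚ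
      restore = solve-∀ ℚ-ring

    potential-nonNeg : ∀ α → 0ℚ ≤ potential α
    potential-nonNeg []      = 0≤1
    potential-nonNeg (X ∷ β) = *-nonNeg (s-nonNeg X) (potential-nonNeg β)

    potential-≤1 : ∀ α → potential α ≤ 1ℚ
    potential-≤1 []      = ≤-refl
    potential-≤1 (X ∷ β) =
      *-mono-≤-0≤ (s-nonNeg X) (s-≤1 X) (potential-nonNeg β) (potential-≤1 β)

    potential-descend : ∀ X β → potential (descend X β) ≡ potential (descend X []) * potential β
    potential-descend zero    β = sym (*-identityˡ (potential β))
    potential-descend (suc j) β = cong (_* potential β) (sym (*-identityʳ (s (inject₁ j))))

    s-step-bound : ∀ X → s X ≤ z * (½ * (s X * s X) + ½ * potential (descend X []))
    s-step-bound zero    = ≤-by-gap _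
      (+-nonNeg (*-nonNeg (*-nonNeg 0≤D 0≤D) (+-nonNeg 0≤1 (*-nonNeg (*-nonNeg 0≤2 0≤D) 0≤1-D)))
                (*-nonNeg (p≤q⇒0≤q-p (u^2^n≤weight² 0≤u u≤½ X₁)) (+-nonNeg (*-nonNeg 0≤1-D 0≤1-D) (*-nonNeg 0≤D 0≤D))))
      (identity D η)
      where
      D = weight X₁
      0≤D : 0ℚ ≤ D
      0≤D = weight-nonNeg 0≤u u≤½ X₁
      0≤1-D : 0ℚ ≤ 1ℚ - D
      0≤1-D = p≤q⇒0≤q-p (≤-trans (weight-≤½ 0≤u u≤½ X₁) ½≤1)
      identity : ∀ D η → 1ℚ - (1ℚ + 1ℚ) * D
          + (D * D * (1ℚ + (1ℚ + 1ℚ) * D * (1ℚ - D)) + (D * D - η) * ((1ℚ - D) * (1ℚ - D) + D * D))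
        ≡ (1ℚ - η) * (½ * ((1ℚ - (1ℚ + 1ℚ) * D) * (1ℚ - (1ℚ + 1ℚ) * D)) + ½ * 1ℚ)
      identity = solve-∀ ℚ-ring
    s-step-bound (suc j) = ≤-by-gap _
      (+-nonNeg (*-nonNeg (p≤q⇒0≤q-p (u^2^n≤weight² 0≤u u≤½ (suc j))) (*-nonNeg 0≤1-a 0≤1-a))
                (*-nonNeg (*-nonNeg 0≤a 0≤a) (*-nonNeg 0≤a (+-nonNeg 0≤1 0≤1-a))))
      (trans (identity a η) (cong (λ w → z * (½ * (s (suc j) * s (suc j)) + ½ * ((1ℚ - (1ℚ + 1ℚ) * w) * 1ℚ)))
                                  (sym (weight-inject₁ j))))
      where
      a = weight (suc j)
      0≤a : 0ℚ ≤ a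
      0≤a = weight-nonNeg 0≤u u≤½ (suc j)
      0≤1-a : 0ℚ ≤ 1ℚ - a
      0≤1-a = p≤q⇒0≤q-p (≤-trans (weight-≤½ 0≤u u≤½ (suc j)) ½≤1)
      identity : ∀ a η → 1ℚ - (1ℚ + 1ℚ) * a
          + ((a * a - η) * ((1ℚ - a) * (1ℚ - a)) + a * a * (a * (1ℚ + (1ℚ - a))))
        ≡ (1ℚ - η) * (½ * ((1ℚ - (1ℚ + 1ℚ) * a) * (1ℚ - (1ℚ + 1ℚ) * a)) + ½ * ((1ℚ - (1ℚ + 1ℚ) * (a * a)) * 1ℚ))
      identity = solve-∀ ℚ-ring

    0≤z : 0ℚ ≤ z
    0≤z = p≤q⇒0≤q-p (^ℚ-≤1 0≤u (≤-trans u≤½ ½≤1) (2 ^ suc h'))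

    z≤1 : z ≤ 1ℚ
    z≤1 = 1-‿antimono-≤ (^ℚ-nonNeg 0≤u (2 ^ suc h'))

    potential-Term-lower : ∀ m α → potential α - z ^ℚ m ≤ Term m α
    potential-Term-lower zero    []      = ≤ᵇ⇒≤ _
    potential-Term-lower zero    (X ∷ β) = +-monoˡ-≤ (- 1ℚ) (potential-≤1 (X ∷ β))
    potential-Term-lower (suc m) []      = 1-‿antimono-≤ (^ℚ-nonNeg 0≤z (suc m))
    potential-Term-lower (suc m) (X ∷ β) = begin
      s X * Πβ - z * Z
        ≤⟨ ≤-by-gap _ (*-nonNeg (potential-nonNeg β) (p≤q⇒0≤q-p (s-step-bound X))) regroup ⟩
      z * (½ * (potential (X ∷ X ∷ β) - Z) + ½ * (potential (descend X β) - Z))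
        ≤⟨ *-monoˡ-≤-0≤ 0≤z (½-average-mono-≤ (potential-Term-lower m (X ∷ X ∷ β))
                                              (potential-Term-lower m (descend X β))) ⟩
      z * (½ * Term m (X ∷ X ∷ β) + ½ * Term m (descend X β))
        ≡⟨ cong (z *_) (Term-step m X β) ⟨
      z * Term (suc m) (X ∷ β)
        ≤⟨ *-monoʳ-≤-0≤ (Term-nonNeg (suc m) (X ∷ β)) z≤1 ⟩
      1ℚ * Term (suc m) (X ∷ β)
        ≡⟨ *-identityˡ _ ⟩
      Term (suc m) (X ∷ β)
        ∎
      where
      Πβ = potential β
      Z  = z ^ℚ m
      l  = potential (descend X [])
      identity : ∀ σ p z Z l → σ * p - z * Z + p * (z * (½ * (σ * σ) + ½ * l) - σ)
               ≡ z * (½ * (σ * (σ * p) - Z) + ½ * (l * p - Z))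
      identity = solve-∀ ℚ-ring
      regroup : s X * Πβ - z * Z + Πβ * (z * (½ * (s X * s X) + ½ * l) - s X)
              ≡ z * (½ * (potential (X ∷ X ∷ β) - Z) + ½ * (potential (descend X β) - Z))
      regroup = trans (identity (s X) Πβ z Z l)
        (cong (λ d → z * (½ * (potential (X ∷ X ∷ β) - Z) + ½ * (d - Z))) (sym (potential-descend X β)))

    Surv-top-upper : ∀ m → S m (Xtop h' ∷ []) ≤ (1ℚ + 1ℚ) * u + z ^ℚ m
    Surv-top-upper m = ≤-by-gap _ (p≤q⇒0≤q-p (potential-Term-lower m (Xtop h' ∷ [])))
      (trans (identity (S m (Xtop h' ∷ [])) (weight (Xtop h')) (z ^ℚ m))
             (cong (λ w → (1ℚ + 1ℚ) * w + z ^ℚ m) (weight-fromℕ h')))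
      where
      identity : ∀ σ w Z → σ + ((1ℚ - σ) - ((1ℚ - (1ℚ + 1ℚ) * w) * 1ℚ - Z)) ≡ (1ℚ + 1ℚ) * w + Z
      identity = solve-∀ ℚ-ring

  Surv-top-vanishes : ∀ ε → 0ℚ < ε → ∃[ N ] S N (Xtop h' ∷ []) ≤ ε
  Surv-top-vanishes ε 0<ε with ≤-total ε 1ℚ
  ... | inj₂ 1≤ε = 0 , ≤-trans (Surv-≤1 0 (Xtop h' ∷ [])) 1≤ε
  ... | inj₁ ε≤1 =
    let N , zᴺ≤ε/2 = ^ℚ-vanishes (^ℚ-pos 0<u (2 ^ suc h')) (^ℚ-≤1 0≤u (≤-trans u≤½ ½≤1) (2 ^ suc h'))
                                 (*-pos 0<½ 0<ε)
    in  N , (begin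
      S N (Xtop h' ∷ [])                       ≤⟨ Surv-top-upper 0≤u u≤½ N ⟩
      (1ℚ + 1ℚ) * u + z 0≤u u≤½ ^ℚ N           ≤⟨ +-monoʳ-≤ ((1ℚ + 1ℚ) * u) zᴺ≤ε/2 ⟩
      (1ℚ + 1ℚ) * u + ½ * ε                    ≡⟨ halves ε ⟩
      ε                                        ∎)
    where
    u = ½ * (½ * ε)
    0<u : 0ℚ < u
    0<u = *-pos 0<½ (*-pos 0<½ 0<ε)
    0≤u : 0ℚ ≤ u
    0≤u = <⇒≤ 0<u
    u≤½ : u ≤ ½
    u≤½ = ≤-trans (*-monoˡ-≤-0≤ 0≤½ (*-monoˡ-≤-0≤ 0≤½ ε≤1)) (≤ᵇ⇒≤ _)
    halves : ∀ ε → (1ℚ + 1ℚ) * (½ * (½ * ε)) + ½ * ε ≡ ε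
    halves = solve-∀ ℚ-ring

proposition8 : (h' : ℕ) →
    ((ε : ℚ) → 0ℚ < ε → ∃[ N ] Surv (Δ h') N (Xtop h' ∷ []) ≤ ε)
    × ((B : ℚ) → ∃[ N ] B ≤ ExpPartial (Δ h') (Xtop h' ∷ []) N)
    × (∃[ c ] (0ℚ < c × ((n : ℕ) →
    (c ^ℚ (2 ^ suc h')) ≤ ℕ→ℚ (suc n) * (ProbTGe (Δ h') (Xtop h' ∷ []) (suc n) ^ℚ (2 ^ suc h')))))
proposition8 h' =
    Surv-top-vanishes
  , ExpPartial-unbounded (Δ h') Xₕ (λ m → Surv-antitone m Xₕ) (λ m → Surv-nonNeg m Xₕ)
                         (2 ^ suc h') (2≤2^[1+n] h') (^ℚ-pos 0<½ 4) Surv-top-tail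
  , (½ ^ℚ 4 , ^ℚ-pos 0<½ 4 , Surv-top-tail)
  where
  open Δ-Survival h'
  Xₕ = Xtop h' ∷ []
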